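{- Let $A=\{a_1,\ldots,a_d\}$ with $a_1<a_2<\cdots<a_d$ positive integers. Then $$C_{123}(x,y,z)=\frac{1}{1-t^1(A)-\sum\limits_{p=3}^d\sum\limits_{j=0}^{p-3}\binom{p-3}{j}t^{p+j}(A)(y-1)^{p-2}},$$ where $t^p(A)=\sum_{1\leq i_1<i_2<\cdots<i_p\leq d}z^p\prod_{j=1}^p x^{a_{i_j}}$ (so $t^p(A)=0$ for $p>d$).
   Context: A composition of $n$ with parts in $A$ is a finite sequence $\sigma=\sigma_1\cdots\sigma_m$ ($m\ge0$) of elements of $A$ summing to $n$; $m$ is its number of parts (the empty composition is included). An occurrence of the pattern $123$ in $\sigma$ is an index $i$, $1\le i\le m-2$, with $\sigma_i<\sigma_{i+1}<\sigma_{i+2}$. $C_{123}(x,y,z)=\sum_\sigma x^{n(\sigma)}y^{r(\sigma)}z^{m(\sigma)}$, summing over all compositions $\sigma$ with parts in $A$, where $n(\sigma)$ is the sum of parts, $m(\sigma)$ the number of parts and $r(\sigma)$ the number of occurrences of $123$ in $\sigma$. -}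

module Defs where

open import Level using (Level)
open import Data.Nat as ℕ using (ℕ; zero; suc; _∸_; _<_; _≟_)
open import Data.Nat.Combinatorics using (_C_)
open import Data.List using (List; []; _∷_; map; concatMap; upTo; filter; length)
open import Data.Nat.ListAction using (sum)
open import Data.Bool using (true; false; if_then_else_)
open import Relation.Nullary using (does)
open import Algebra.Bundles using (CommutativeRing; Semiring)
import Algebra.Definitions.RawSemiring as RS

words : List ℕ → ℕ → List (List ℕ)
words A zero    = [] ∷ []
words A (suc m) = concatMap (λ a → map (a ∷_) (words A m)) A

-- Compositions of n with parts in A: sequences of elements of A summing to n.
-- (Parts are positive, so a composition of n has at most n parts; we list
-- all words of length 0..n and keep those with sum n.)
compositions : List ℕ → ℕ → List (List ℕ)
compositions A n = filter (λ σ → sum σ ≟ n) (concatMap (words A) (upTo (suc n)))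

occ123 : List ℕ → ℕ
occ123 (a ∷ b ∷ c ∷ σ) =
  (if does (a ℕ.<? b) then (if does (b ℕ.<? c) then 1 else 0) else 0)
  ℕ.+ occ123 (b ∷ c ∷ σ)
occ123 _ = 0

-- All subsequences of a list (for a strictly increasing list a_1<...<a_d these
-- are exactly the index sets i_1 < ... < i_p).
sublists : List ℕ → List (List ℕ)
sublists []      = [] ∷ []
sublists (a ∷ A) = map (a ∷_) (sublists A) Data.List.++ sublists A

count : List ℕ → ℕ → ℕ → ℕ
count A p j = length (filter (λ S → sum S ≟ j) (filter (λ S → length S ≟ p) (sublists A)))

range : ℕ → ℕ → List ℕ
range a b = map (a ℕ.+_) (upTo (suc b ∸ a))

-- Formal power series in x with coefficients in a commutative ring R
-- (a series is its coefficient sequence).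
module Series {c ℓ : Level} (R : CommutativeRing c ℓ) where
  open CommutativeRing R
  open RS (Semiring.rawSemiring semiring) using (_^_; _×_)

  Ser : Set c
  Ser = ℕ → Carrier

  Σl : {B : Set} → List B → (B → Carrier) → Carrier
  Σl []       f = 0#
  Σl (b ∷ bs) f = f b + Σl bs f

  _⊗_ : Ser → Ser → Ser
  (f ⊗ g) n = Σl (upTo (suc n)) (λ k → f k * g (n ∸ k))

  _⊕_ : Ser → Ser → Ser
  (f ⊕ g) n = f n + g n

  ⊝_ : Ser → Ser
  (⊝ f) n = - f n

  _·_ : Carrier → Ser → Ser
  (r · f) n = r * f n

  oneS : Ser
  oneS zero    = 1#
  oneS (suc _) = 0#

  ΣS : {B : Set} → List B → (B → Ser) → Ser
  ΣS bs F n = Σl bs (λ b → F b n)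

  -- C_123(x,y,z) = Σ_σ x^{n(σ)} y^{r(σ)} z^{m(σ)}, as a series in x.
  C123 : List ℕ → Carrier → Carrier → Ser
  C123 A y z n = Σl (compositions A n) (λ σ → (y ^ occ123 σ) * (z ^ length σ))

  t : List ℕ → Carrier → ℕ → Ser
  t A z p j = count A p j × (z ^ p)

  D : List ℕ → Carrier → Carrier → Ser
  D A y z = oneS ⊕ (⊝ (t A z 1 ⊕ ΣS (range 3 (length A)) (λ p →
              ΣS (range 0 (p ∸ 3)) (λ j →
                ((((p ∸ 3) C j) × 1#) * ((y - 1#) ^ (p ∸ 2))) · t A z (p ℕ.+ j)))))

-- Goulden–Jackson cluster method.  Write y = 1 + u and expand y ^ occ123 σ as a sum over sets of
-- marked 123-occurrences, each weighing u.  Chains of overlapping marked occurrences cover strictly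
-- increasing runs ("clusters"); the total weight of the coverings of a run of length q obeys
-- c (q+3) = u (c (q+2) + c (q+1)), a Fibonacci-type recursion whose closed form is the binomial sum
-- in the denominator.  Cutting a composition after its first cluster (a single part counting as a
-- cluster of length 1) gives C = 1 + C · K, where K sums the clusters; as A is sorted these are the
-- increasing sublists of A, so 1 − K is exactly the stated denominator and C (1 − K) = 1.

module Submission where

open import Defs
open import Level using (Level)
open import Data.Nat using (ℕ; _<_)
open import Data.List using (List)
open import Data.List.Relation.Unary.All using (All)
open import Data.List.Relation.Unary.AllPairs using (AllPairs)
open import Algebra.Bundles using (CommutativeRing)

open import Data.Nat as ℕ using (zero; suc; _∸_; _≤_; _≟_; _≤?_; _<?_; z≤n; s≤s)
import Data.Nat.Properties as ℕ
open import Data.Nat.ListAction using (sum)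
open import Data.Nat.Combinatorics using (_C_; k>n⇒nCk≡0; nCk+nC[k+1]≡[n+1]C[k+1])
open import Data.List
  using ([]; _∷_; _++_; _∷ʳ_; [_]; map; concatMap; filter; length; upTo; applyUpTo)
open import Data.Bool.ListAction using (all)
open import Data.List.Properties using (upTo-∷ʳ)
open import Data.List.Relation.Unary.All as All using ([]; _∷_)
open import Data.List.Relation.Unary.All.Properties using (++⁺; map⁺; applyUpTo⁺₁)
open import Data.List.Relation.Unary.AllPairs using ([]; _∷_)
open import Data.Bool using (Bool; true; false; if_then_else_; _∧_)
open import Data.Product using (_,_)
open import Data.Sum using (inj₁; inj₂)
open import Function using (_∘_; mk⇔)
open import Relation.Nullary using (Dec; does; yes; no; ¬_)
open import Relation.Nullary.Decidable using (dec-true; dec-false; does-⇔; _×-dec_)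
open import Relation.Binary.Definitions using (tri<; tri≈; tri>)
open import Data.Nat.Induction using (<-rec)
open import Relation.Binary.PropositionalEquality as ≡ using (_≡_)
open import Algebra.Bundles using (Semiring)
import Algebra.Definitions.RawSemiring as RawSemiring
import Algebra.Properties.Monoid.Mult as MonoidMultProperties
import Algebra.Properties.Ring as RingProperties
import Algebra.Properties.Group as GroupProperties
import Algebra.Properties.CommutativeSemigroup as CommutativeSemigroupProperties
import Algebra.Solver.Ring.NaturalCoefficients.Default as Solver
import Relation.Binary.Reasoning.Setoid as SetoidReasoning

module Sums {c ℓ : Level} (R : CommutativeRing c ℓ) where
  open CommutativeRing R hiding (zero)
  open Series R using (Σl)
  open RawSemiring (Semiring.rawSemiring semiring) using (_×_)
  open RingProperties ring using (-0#≈0#; -‿+-comm)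
  open CommutativeSemigroupProperties +-commutativeSemigroup using (interchange)
  open SetoidReasoning setoid

  when : Bool → Carrier → Carrier
  when b x = if b then x else 0#

  when-cong : ∀ b {x x′} → x ≈ x′ → when b x ≈ when b x′
  when-cong true  x≈x′ = x≈x′
  when-cong false _    = refl

  when-≡ : ∀ {b b′} x → b ≡ b′ → when b x ≈ when b′ x
  when-≡ x ≡.refl = refl

  when-true : ∀ {p} {P : Set p} (P? : Dec P) → P → ∀ x → when (does P?) x ≈ x
  when-true P? p x rewrite dec-true P? p = refl

  when-false : ∀ {p} {P : Set p} (P? : Dec P) → ¬ P → ∀ x → when (does P?) x ≈ 0#
  when-false P? ¬p x rewrite dec-false P? ¬p = refl

  when-congᵈ : ∀ {p} {P : Set p} (P? : Dec P) {x x′} → (P → x ≈ x′) → when (does P?) x ≈ when (does P?) x′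
  when-congᵈ (yes p) x≈x′ = x≈x′ p
  when-congᵈ (no _)  _    = refl

  when-absorb : ∀ {p} {P : Set p} (P? : Dec P) {x} → (¬ P → x ≈ 0#) → when (does P?) x ≈ x
  when-absorb (yes _) _  = refl
  when-absorb (no ¬p) x≈0 = sym (x≈0 ¬p)

  when-0 : ∀ b → when b 0# ≈ 0#
  when-0 true  = refl
  when-0 false = refl

  when-+ : ∀ b x x′ → when b (x + x′) ≈ when b x + when b x′
  when-+ true  x x′ = refl
  when-+ false x x′ = sym (+-identityˡ 0#)

  when-*ˡ : ∀ b r x → when b (r * x) ≈ r * when b x
  when-*ˡ true  r x = refl
  when-*ˡ false r x = sym (zeroʳ r)

  when-*ʳ : ∀ b r x → when b (x * r) ≈ when b x * r
  when-*ʳ true  r x = refl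
  when-*ʳ false r x = sym (zeroˡ r)

  when-∧ : ∀ b b′ x → when (b ∧ b′) x ≈ when b (when b′ x)
  when-∧ true  b′ x = refl
  when-∧ false b′ x = refl

  when-comm : ∀ b b′ x → when b (when b′ x) ≈ when b′ (when b x)
  when-comm true  b′    x = refl
  when-comm false true  x = refl
  when-comm false false x = refl

  module _ {B : Set} where

    Σl-cong : ∀ (xs : List B) {f g : B → Carrier} → (∀ x → f x ≈ g x) → Σl xs f ≈ Σl xs g
    Σl-cong []       f≈g = refl
    Σl-cong (x ∷ xs) f≈g = +-cong (f≈g x) (Σl-cong xs f≈g)

    Σl-congᴬ : ∀ {p} {P : B → Set p} {xs f g} → All P xs → (∀ x → P x → f x ≈ g x) → Σl xs f ≈ Σl xs g
    Σl-congᴬ []         f≈g = refl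
    Σl-congᴬ (px ∷ pxs) f≈g = +-cong (f≈g _ px) (Σl-congᴬ pxs f≈g)

    Σl-0 : ∀ (xs : List B) → Σl xs (λ _ → 0#) ≈ 0#
    Σl-0 []       = refl
    Σl-0 (x ∷ xs) = trans (+-identityˡ _) (Σl-0 xs)

    Σl-+ : ∀ (xs : List B) f g → Σl xs (λ x → f x + g x) ≈ Σl xs f + Σl xs g
    Σl-+ []       f g = sym (+-identityˡ 0#)
    Σl-+ (x ∷ xs) f g = trans (+-congˡ (Σl-+ xs f g)) (interchange (f x) (g x) _ _)

    Σl-*ˡ : ∀ (xs : List B) r f → Σl xs (λ x → r * f x) ≈ r * Σl xs f
    Σl-*ˡ []       r f = sym (zeroʳ r)
    Σl-*ˡ (x ∷ xs) r f = trans (+-congˡ (Σl-*ˡ xs r f)) (sym (distribˡ r (f x) _))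

    Σl-*ʳ : ∀ (xs : List B) r f → Σl xs (λ x → f x * r) ≈ Σl xs f * r
    Σl-*ʳ xs r f = trans (Σl-cong xs (λ x → *-comm (f x) r)) (trans (Σl-*ˡ xs r f) (*-comm r _))

    Σl-neg : ∀ (xs : List B) f → Σl xs (λ x → - f x) ≈ - Σl xs f
    Σl-neg []       f = sym -0#≈0#
    Σl-neg (x ∷ xs) f = trans (+-congˡ (Σl-neg xs f)) (-‿+-comm (f x) _)

    Σl-const : ∀ (xs : List B) r → Σl xs (λ _ → r) ≈ length xs × r
    Σl-const []       r = refl
    Σl-const (x ∷ xs) r = +-congˡ (Σl-const xs r)

    Σl-when : ∀ (xs : List B) b f → Σl xs (λ x → when b (f x)) ≈ when b (Σl xs f)
    Σl-when xs true  f = refl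
    Σl-when xs false f = Σl-0 xs

    Σl-++ : ∀ (xs ys : List B) f → Σl (xs ++ ys) f ≈ Σl xs f + Σl ys f
    Σl-++ []       ys f = sym (+-identityˡ _)
    Σl-++ (x ∷ xs) ys f = trans (+-congˡ (Σl-++ xs ys f)) (sym (+-assoc _ _ _))

    Σl-filter : ∀ {p} {P : B → Set p} (P? : ∀ x → Dec (P x)) xs f →
                Σl (filter P? xs) f ≈ Σl xs (λ x → when (does (P? x)) (f x))
    Σl-filter P? []       f = refl
    Σl-filter P? (x ∷ xs) f with does (P? x)
    ... | true  = +-congˡ (Σl-filter P? xs f)
    ... | false = trans (Σl-filter P? xs f) (sym (+-identityˡ _))

  Σl-swap : ∀ {B D : Set} (xs : List B) (ys : List D) (f : B → D → Carrier) →
            Σl xs (λ x → Σl ys (f x)) ≈ Σl ys (λ y → Σl xs (λ x → f x y))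
  Σl-swap []       ys f = sym (Σl-0 ys)
  Σl-swap (x ∷ xs) ys f = trans (+-congˡ (Σl-swap xs ys f)) (sym (Σl-+ ys (f x) _))

  Σl-map : ∀ {B D : Set} (g : B → D) xs (f : D → Carrier) → Σl (map g xs) f ≡ Σl xs (f ∘ g)
  Σl-map g []       f = ≡.refl
  Σl-map g (x ∷ xs) f = ≡.cong (f (g x) +_) (Σl-map g xs f)

  Σl-concatMap : ∀ {B D : Set} (g : B → List D) xs (f : D → Carrier) → Σl (concatMap g xs) f ≈ Σl xs (λ x → Σl (g x) f)
  Σl-concatMap g []       f = refl
  Σl-concatMap g (x ∷ xs) f = trans (Σl-++ (g x) _ f) (+-congˡ (Σl-concatMap g xs f))

  Σl-upTo-suc : ∀ n (h : ℕ → Carrier) → Σl (upTo (suc n)) h ≡ h 0 + Σl (upTo n) (h ∘ suc)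
  Σl-upTo-suc n h = ≡.cong (h 0 +_) (shift suc n h)
    where
      shift : ∀ g n (h : ℕ → Carrier) → Σl (applyUpTo g n) h ≡ Σl (upTo n) (h ∘ g)
      shift g zero    h = ≡.refl
      shift g (suc n) h = ≡.cong (h (g 0) +_) (≡.trans (shift (g ∘ suc) n h) (≡.sym (shift suc n (h ∘ g))))

  Σl-upTo-∷ʳ : ∀ n (h : ℕ → Carrier) → Σl (upTo (suc n)) h ≈ Σl (upTo n) h + h n
  Σl-upTo-∷ʳ n h = begin
    Σl (upTo (suc n)) h        ≡⟨ ≡.cong (λ xs → Σl xs h) (upTo-∷ʳ n) ⟨
    Σl (upTo n ∷ʳ n) h         ≈⟨ Σl-++ (upTo n) [ n ] h ⟩
    Σl (upTo n) h + (h n + 0#) ≈⟨ +-congˡ (+-identityʳ (h n)) ⟩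
    Σl (upTo n) h + h n        ∎

  Σl-upTo-δ : ∀ N t (g : ℕ → Carrier) → Σl (upTo N) (λ k → when (does (k ≟ t)) (g k)) ≈ when (does (t <? N)) (g t)
  Σl-upTo-δ zero    t       g = refl
  Σl-upTo-δ (suc N) zero    g = trans (reflexive (Σl-upTo-suc N _)) (trans (+-congˡ (Σl-0 (upTo N))) (+-identityʳ _))
  Σl-upTo-δ (suc N) (suc t) g = trans (reflexive (Σl-upTo-suc N _)) (trans (+-identityˡ _) (Σl-upTo-δ N t (g ∘ suc)))

  Σl-upTo-δ∸ : ∀ n j (g : ℕ → Carrier) →
               Σl (upTo (suc n)) (λ k → when (does (j ≟ n ∸ k)) (g k)) ≈ when (does (j ≤? n)) (g (n ∸ j))
  Σl-upTo-δ∸ n j g = begin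
    Σl (upTo (suc n)) (λ k → when (does (j ≟ n ∸ k)) (g k))
      ≈⟨ Σl-congᴬ (applyUpTo⁺₁ (λ k → k) (suc n) ℕ.≤-pred) (λ k k≤n → when-≡ (g k) (reindex k≤n)) ⟩
    Σl (upTo (suc n)) (λ k → when (does (j ≤? n) ∧ does (k ≟ n ∸ j)) (g k))
      ≈⟨ Σl-cong (upTo (suc n)) (λ k → when-∧ (does (j ≤? n)) _ (g k)) ⟩
    Σl (upTo (suc n)) (λ k → when (does (j ≤? n)) (when (does (k ≟ n ∸ j)) (g k)))
      ≈⟨ Σl-when (upTo (suc n)) (does (j ≤? n)) _ ⟩
    when (does (j ≤? n)) (Σl (upTo (suc n)) (λ k → when (does (k ≟ n ∸ j)) (g k)))
      ≈⟨ when-cong (does (j ≤? n)) (Σl-upTo-δ (suc n) (n ∸ j) g) ⟩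
    when (does (j ≤? n)) (when (does (n ∸ j <? suc n)) (g (n ∸ j)))
      ≈⟨ when-cong (does (j ≤? n)) (when-true (n ∸ j <? suc n) (s≤s (ℕ.m∸n≤m n j)) _) ⟩
    when (does (j ≤? n)) (g (n ∸ j)) ∎
    where
      reindex : ∀ {k} → k ≤ n → does (j ≟ n ∸ k) ≡ does ((j ≤? n) ×-dec (k ≟ n ∸ j))
      reindex {k} k≤n = does-⇔ (mk⇔
        (λ { ≡.refl → ℕ.m∸n≤m n k , ≡.sym (ℕ.m∸[m∸n]≡n k≤n) })
        (λ { (j≤n , ≡.refl) → ≡.sym (ℕ.m∸[m∸n]≡n j≤n) })) (j ≟ n ∸ k) ((j ≤? n) ×-dec (k ≟ n ∸ j))

module NatDecidability where

  ≤?-suc : ∀ a b → does (suc a ≤? suc b) ≡ does (a ≤? b)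
  ≤?-suc a b = does-⇔ (mk⇔ ℕ.≤-pred s≤s) (suc a ≤? suc b) (a ≤? b)

  ≟-+ˡ : ∀ a s n → does (a ℕ.+ s ≟ n) ≡ does (a ≤? n) ∧ does (s ≟ n ∸ a)
  ≟-+ˡ a s n = does-⇔ (mk⇔
    (λ { ≡.refl → ℕ.m≤m+n a s , ≡.sym (ℕ.m+n∸m≡n a s) })
    (λ { (a≤n , ≡.refl) → ℕ.m+[n∸m]≡n a≤n })) (a ℕ.+ s ≟ n) ((a ≤? n) ×-dec (s ≟ n ∸ a))

  ≤?-+ˡ : ∀ a s n → does (a ℕ.+ s ≤? n) ≡ does (a ≤? n) ∧ does (s ≤? n ∸ a)
  ≤?-+ˡ a s n = does-⇔ (mk⇔
    (λ a+s≤n → ℕ.≤-trans (ℕ.m≤m+n a s) a+s≤n , ≡.subst (_≤ n ∸ a) (ℕ.m+n∸m≡n a s) (ℕ.∸-monoˡ-≤ a a+s≤n))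
    (λ { (a≤n , s≤n∸a) → ≡.subst (a ℕ.+ s ≤_) (ℕ.m+[n∸m]≡n a≤n) (ℕ.+-monoʳ-≤ a s≤n∸a) }))
    (a ℕ.+ s ≤? n) ((a ≤? n) ×-dec (s ≤? n ∸ a))

  ≟-+ʳ : ∀ q p j → does (q ≟ p ℕ.+ j) ≡ does (p ≤? q) ∧ does (j ≟ q ∸ p)
  ≟-+ʳ q p j = ≡.trans (does-⇔ (mk⇔ ≡.sym ≡.sym) (q ≟ p ℕ.+ j) (p ℕ.+ j ≟ q)) (≟-+ˡ p j q)

module SeriesProperties {c ℓ : Level} (R : CommutativeRing c ℓ) where
  open CommutativeRing R hiding (zero)
  open Series R
  open Sums R
  open RingProperties ring using (-‿distribʳ-*)
  open SetoidReasoning setoid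

  oneS≈δ : ∀ j → oneS j ≈ when (does (0 ≟ j)) 1#
  oneS≈δ zero    = refl
  oneS≈δ (suc j) = refl

  ⊗-congʳ : ∀ f {g g′ : Ser} → (∀ k → g k ≈ g′ k) → ∀ n → (f ⊗ g) n ≈ (f ⊗ g′) n
  ⊗-congʳ f g≈g′ n = Σl-cong (upTo (suc n)) (λ k → *-congˡ (g≈g′ (n ∸ k)))

  ⊗-oneSʳ : ∀ f n → (f ⊗ oneS) n ≈ f n
  ⊗-oneSʳ f n = begin
    Σl (upTo (suc n)) (λ k → f k * oneS (n ∸ k))
      ≈⟨ Σl-cong (upTo (suc n)) (λ k → trans (*-congˡ (oneS≈δ (n ∸ k)))
           (trans (sym (when-*ˡ _ (f k) 1#)) (when-cong _ (*-identityʳ (f k))))) ⟩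
    Σl (upTo (suc n)) (λ k → when (does (0 ≟ n ∸ k)) (f k)) ≈⟨ Σl-upTo-δ∸ n 0 f ⟩
    when (does (0 ≤? n)) (f n)                              ≈⟨ when-true (0 ≤? n) z≤n (f n) ⟩
    f n                                                     ∎

  ⊗-oneS-⊝ʳ : ∀ f g n → (f ⊗ (oneS ⊕ (⊝ g))) n ≈ f n - (f ⊗ g) n
  ⊗-oneS-⊝ʳ f g n = begin
    Σl (upTo (suc n)) (λ k → f k * (oneS (n ∸ k) + - g (n ∸ k)))
      ≈⟨ Σl-cong (upTo (suc n)) (λ k → trans (distribˡ (f k) _ _) (+-congˡ (sym (-‿distribʳ-* (f k) _)))) ⟩
    Σl (upTo (suc n)) (λ k → f k * oneS (n ∸ k) + - (f k * g (n ∸ k)))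
      ≈⟨ Σl-+ (upTo (suc n)) _ _ ⟩
    (f ⊗ oneS) n + Σl (upTo (suc n)) (λ k → - (f k * g (n ∸ k)))
      ≈⟨ +-cong (⊗-oneSʳ f n) (Σl-neg (upTo (suc n)) _) ⟩
    f n - (f ⊗ g) n ∎

sublists-length : ∀ B → All (λ S → length S ≤ length B) (sublists B)
sublists-length []      = z≤n ∷ []
sublists-length (a ∷ B) = ++⁺ (map⁺ (All.map s≤s (sublists-length B))) (All.map ℕ.m≤n⇒m≤1+n (sublists-length B))

module SublistSums {c ℓ : Level} (R : CommutativeRing c ℓ) where
  open CommutativeRing R hiding (zero)
  open Series R using (Σl)
  open Sums R
  open CommutativeSemigroupProperties +-commutativeSemigroup using (x∙yz≈y∙xz)
  open SetoidReasoning setoid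

  above : ℕ → List ℕ → Bool
  above b = all (λ c → does (b <? c))

  Σl-sublists-∷ : ∀ a B (h : List ℕ → Carrier) →
                  Σl (sublists (a ∷ B)) h ≈ Σl (sublists B) (h ∘ (a ∷_)) + Σl (sublists B) h
  Σl-sublists-∷ a B h = trans (Σl-++ (map (a ∷_) (sublists B)) (sublists B) h)
                              (+-congʳ (reflexive (Σl-map (a ∷_) (sublists B) h)))

  Σl-above-all : ∀ {b} B → All (b <_) B → ∀ (h : List ℕ → Carrier) →
                 Σl (sublists B) (λ S → when (above b S) (h S)) ≈ Σl (sublists B) h
  Σl-above-all         []      []            h = refl
  Σl-above-all {b} (a ∷ B) (b<a ∷ b<B) h = begin
    Σl (sublists (a ∷ B)) (λ S → when (above b S) (h S))
      ≈⟨ Σl-sublists-∷ a B _ ⟩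
    Σl (sublists B) (λ S → when (does (b <? a) ∧ above b S) (h (a ∷ S))) + Σl (sublists B) (λ S → when (above b S) (h S))
      ≈⟨ +-cong (Σl-cong (sublists B) (λ S → trans (when-∧ (does (b <? a)) _ _) (when-true (b <? a) b<a _)))
                (Σl-above-all B b<B h) ⟩
    Σl (sublists B) (λ S → when (above b S) (h (a ∷ S))) + Σl (sublists B) h
      ≈⟨ +-congʳ (Σl-above-all B b<B (h ∘ (a ∷_))) ⟩
    Σl (sublists B) (h ∘ (a ∷_)) + Σl (sublists B) h
      ≈⟨ Σl-sublists-∷ a B h ⟨
    Σl (sublists (a ∷ B)) h ∎

  Σl-above-skip : ∀ {a c} B → ¬ c < a → ∀ (h : List ℕ → Carrier) →
                  Σl (sublists (a ∷ B)) (λ S → when (above c S) (h S)) ≈ Σl (sublists B) (λ S → when (above c S) (h S))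
  Σl-above-skip {a} {c} B c≮a h = begin
    Σl (sublists (a ∷ B)) (λ S → when (above c S) (h S))
      ≈⟨ Σl-sublists-∷ a B _ ⟩
    Σl (sublists B) (λ S → when (does (c <? a) ∧ above c S) (h (a ∷ S))) + Σl (sublists B) (λ S → when (above c S) (h S))
      ≈⟨ +-congʳ (trans (Σl-cong (sublists B) (λ S → trans (when-∧ (does (c <? a)) _ _) (when-false (c <? a) c≮a _)))
                        (Σl-0 (sublists B))) ⟩
    0# + Σl (sublists B) (λ S → when (above c S) (h S))
      ≈⟨ +-identityˡ _ ⟩
    Σl (sublists B) (λ S → when (above c S) (h S)) ∎

  Σl-above-∷ : ∀ B → AllPairs _<_ B → ∀ b (h : List ℕ → Carrier) →
               Σl (sublists B) (λ S → when (above b S) (h S))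
                 ≈ h [] + Σl B (λ c → when (does (b <? c)) (Σl (sublists B) (λ S → when (above c S) (h (c ∷ S)))))
  Σl-above-∷ []      []            b h = refl
  Σl-above-∷ (a ∷ B) (a<B ∷ sorted) b h = begin
    Σl (sublists (a ∷ B)) (λ S → when (above b S) (h S))
      ≈⟨ Σl-sublists-∷ a B _ ⟩
    Σl (sublists B) (λ S → when (does (b <? a) ∧ above b S) (h (a ∷ S))) + Σl (sublists B) (λ S → when (above b S) (h S))
      ≈⟨ +-cong (trans (Σl-cong (sublists B) (λ S → when-∧ (does (b <? a)) _ _)) (Σl-when (sublists B) (does (b <? a)) _))
                (Σl-above-∷ B sorted b h) ⟩
    when (does (b <? a)) (Σl (sublists B) (λ S → when (above b S) (h (a ∷ S)))) + (h [] + rest)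
      ≈⟨ x∙yz≈y∙xz _ _ _ ⟩
    h [] + (when (does (b <? a)) (Σl (sublists B) (λ S → when (above b S) (h (a ∷ S)))) + rest)
      ≈⟨ +-congˡ (+-cong (when-congᵈ (b <? a) headTerm)
                         (Σl-congᴬ a<B (λ c a<c → when-cong _ (sym (Σl-above-skip B (ℕ.<⇒≯ a<c) _))))) ⟩
    h [] + Σl (a ∷ B) (λ c → when (does (b <? c)) (Σl (sublists (a ∷ B)) (λ S → when (above c S) (h (c ∷ S))))) ∎
    where
      rest : Carrier
      rest = Σl B (λ c → when (does (b <? c)) (Σl (sublists B) (λ S → when (above c S) (h (c ∷ S)))))
      headTerm : b < a → Σl (sublists B) (λ S → when (above b S) (h (a ∷ S)))
                        ≈ Σl (sublists (a ∷ B)) (λ S → when (above a S) (h (a ∷ S)))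
      headTerm b<a = begin
        Σl (sublists B) (λ S → when (above b S) (h (a ∷ S))) ≈⟨ Σl-above-all B (All.map (ℕ.<-trans b<a) a<B) _ ⟩
        Σl (sublists B) (λ S → h (a ∷ S))                   ≈⟨ Σl-above-all B a<B _ ⟨
        Σl (sublists B) (λ S → when (above a S) (h (a ∷ S))) ≈⟨ Σl-above-skip B (ℕ.<-irrefl ≡.refl) _ ⟨
        Σl (sublists (a ∷ B)) (λ S → when (above a S) (h (a ∷ S))) ∎

module CompositionSums {c ℓ : Level} (R : CommutativeRing c ℓ) (A : List ℕ) (positive : All (0 <_) A) where
  open CommutativeRing R hiding (zero)
  open Series R using (Σl)
  open Sums R
  open NatDecidability
  open SetoidReasoning setoid

  Σcomp : ℕ → (List ℕ → Carrier) → Carrier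
  Σcomp n φ = Σl (compositions A n) φ

  Σwords : ℕ → ℕ → (List ℕ → Carrier) → Carrier
  Σwords m n φ = Σl (words A m) (λ σ → when (does (sum σ ≟ n)) (φ σ))

  Σwords-suc : ∀ m n φ → Σwords (suc m) n φ ≈ Σl A (λ a → when (does (a ≤? n)) (Σwords m (n ∸ a) (φ ∘ (a ∷_))))
  Σwords-suc m n φ = trans (Σl-concatMap (λ a → map (a ∷_) (words A m)) A _) (Σl-cong A (λ a → begin
    Σl (map (a ∷_) (words A m)) (λ σ → when (does (sum σ ≟ n)) (φ σ))
      ≡⟨ Σl-map (a ∷_) (words A m) _ ⟩
    Σl (words A m) (λ τ → when (does (a ℕ.+ sum τ ≟ n)) (φ (a ∷ τ)))
      ≈⟨ Σl-cong (words A m) (λ τ → trans (when-≡ _ (≟-+ˡ a (sum τ) n)) (when-∧ (does (a ≤? n)) _ _)) ⟩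
    Σl (words A m) (λ τ → when (does (a ≤? n)) (when (does (sum τ ≟ n ∸ a)) (φ (a ∷ τ))))
      ≈⟨ Σl-when (words A m) (does (a ≤? n)) _ ⟩
    when (does (a ≤? n)) (Σwords m (n ∸ a) (φ ∘ (a ∷_))) ∎))

  -- Parts are positive, so a word of length m has sum at least m.
  Σwords-vanish : ∀ {m n} φ → n < m → Σwords m n φ ≈ 0#
  Σwords-vanish {suc m} {n} φ (s≤s n≤m) = begin
    Σwords (suc m) n φ
      ≈⟨ Σwords-suc m n φ ⟩
    Σl A (λ a → when (does (a ≤? n)) (Σwords m (n ∸ a) (φ ∘ (a ∷_))))
      ≈⟨ Σl-congᴬ positive (λ a 0<a → trans (when-congᵈ (a ≤? n)
           (λ a≤n → Σwords-vanish _ (ℕ.<-≤-trans (ℕ.∸-monoʳ-< 0<a a≤n) n≤m))) (when-0 _)) ⟩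
    Σl A (λ _ → 0#)
      ≈⟨ Σl-0 A ⟩
    0# ∎

  Σwords≈Σcomp : ∀ {n} N φ → n < N → Σl (upTo N) (λ m → Σwords m n φ) ≈ Σcomp n φ
  Σwords≈Σcomp {n} (suc N) φ (s≤s n≤N) with ℕ.m≤n⇒m<n∨m≡n n≤N
  ... | inj₂ ≡.refl = sym (trans (Σl-filter (λ σ → sum σ ≟ n) (concatMap (words A) (upTo (suc n))) φ)
                                 (Σl-concatMap (words A) (upTo (suc n)) _))
  ... | inj₁ n<N    = begin
    Σl (upTo (suc N)) (λ m → Σwords m n φ)          ≈⟨ Σl-upTo-∷ʳ N _ ⟩
    Σl (upTo N) (λ m → Σwords m n φ) + Σwords N n φ ≈⟨ +-cong (Σwords≈Σcomp N φ n<N) (Σwords-vanish φ n<N) ⟩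
    Σcomp n φ + 0#                                  ≈⟨ +-identityʳ _ ⟩
    Σcomp n φ                                       ∎

  Σcomp-∷ : ∀ n φ → Σcomp n φ ≈ when (does (0 ≟ n)) (φ [])
                                  + Σl A (λ a → when (does (a ≤? n)) (Σcomp (n ∸ a) (φ ∘ (a ∷_))))
  Σcomp-∷ n φ = begin
    Σcomp n φ
      ≈⟨ Σwords≈Σcomp (suc n) φ ℕ.≤-refl ⟨
    Σl (upTo (suc n)) (λ m → Σwords m n φ)
      ≡⟨ Σl-upTo-suc n _ ⟩
    Σwords 0 n φ + Σl (upTo n) (λ m → Σwords (suc m) n φ)
      ≈⟨ +-cong (+-identityʳ _) (Σl-cong (upTo n) (λ m → Σwords-suc m n φ)) ⟩
    when (does (0 ≟ n)) (φ []) + Σl (upTo n) (λ m → Σl A (λ a → when (does (a ≤? n)) (Σwords m (n ∸ a) (φ ∘ (a ∷_)))))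
      ≈⟨ +-congˡ (Σl-swap (upTo n) A _) ⟩
    when (does (0 ≟ n)) (φ []) + Σl A (λ a → Σl (upTo n) (λ m → when (does (a ≤? n)) (Σwords m (n ∸ a) (φ ∘ (a ∷_)))))
      ≈⟨ +-congˡ (Σl-congᴬ positive (λ a 0<a → trans (Σl-when (upTo n) _ _)
           (when-congᵈ (a ≤? n) (λ a≤n → Σwords≈Σcomp n _ (ℕ.∸-monoʳ-< 0<a a≤n))))) ⟩
    when (does (0 ≟ n)) (φ []) + Σl A (λ a → when (does (a ≤? n)) (Σcomp (n ∸ a) (φ ∘ (a ∷_)))) ∎

module ClusterWeights {c ℓ : Level} (R : CommutativeRing c ℓ) (u : CommutativeRing.Carrier R) where
  open CommutativeRing R hiding (zero)
  open RawSemiring (Semiring.rawSemiring semiring) using (_^_; _×_)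
  open MonoidMultProperties +-monoid using (×-homo-+)
  open Series R using (Σl)
  open Sums R
  open SetoidReasoning setoid
  open Solver commutativeSemiring

  -- Goulden–Jackson weight of an increasing run of length q covered by overlapping 123-occurrences,
  -- each occurrence marked by u; a single letter is a cluster of weight 1.
  cluster : ℕ → Carrier
  cluster 0 = 0#
  cluster 1 = 1#
  cluster 2 = 0#
  cluster (suc (suc (suc q))) = u * cluster (suc (suc q)) + u * cluster (suc q)

  fibPoly : ℕ → Carrier
  fibPoly 0 = 1#
  fibPoly 1 = u
  fibPoly (suc (suc m)) = u * fibPoly (suc m) + u * fibPoly m

  cluster-fibPoly : ∀ m → cluster (3 ℕ.+ m) ≈ u * fibPoly m
  cluster-fibPoly zero = trans (+-congʳ (zeroʳ u)) (+-identityˡ _)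
  cluster-fibPoly (suc zero) = trans (+-cong (*-congˡ (trans (cluster-fibPoly zero) (*-identityʳ u))) (zeroʳ u)) (+-identityʳ _)
  cluster-fibPoly (suc (suc m)) = trans (+-cong (*-congˡ (cluster-fibPoly (suc m))) (*-congˡ (cluster-fibPoly m)))
                                        (sym (distribˡ u _ _))

  binomialTerm : ℕ → ℕ → Carrier
  binomialTerm m p = when (does (p ≤? m)) (((p C (m ∸ p)) × 1#) * u ^ p)

  binomialSum : ℕ → ℕ → Carrier
  binomialSum N m = Σl (upTo N) (binomialTerm m)

  binomialTerm-suc : ∀ m p → binomialTerm (2 ℕ.+ m) (suc p) ≈ u * (binomialTerm (suc m) p + binomialTerm m p)
  binomialTerm-suc m p with ℕ.<-cmp p (suc m)
  ... | tri< p<1+m _ _ = begin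
    when (does (suc p ≤? suc (suc m))) (((suc p C (suc m ∸ p)) × 1#) * (u * u ^ p))
      ≈⟨ when-true (suc p ≤? suc (suc m)) (s≤s (ℕ.<⇒≤ p<1+m)) _ ⟩
    ((suc p C (suc m ∸ p)) × 1#) * (u * u ^ p)
      ≡⟨ ≡.cong (λ k → (k × 1#) * (u * u ^ p)) pascal ⟩
    ((p C (m ∸ p) ℕ.+ p C (suc m ∸ p)) × 1#) * (u * u ^ p)
      ≈⟨ *-congʳ (×-homo-+ 1# (p C (m ∸ p)) (p C (suc m ∸ p))) ⟩
    ((p C (m ∸ p)) × 1# + (p C (suc m ∸ p)) × 1#) * (u * u ^ p)
      ≈⟨ solve 4 (λ a b u U → (a :+ b) :* (u :* U) := u :* (b :* U :+ a :* U)) refl _ _ u (u ^ p) ⟩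
    u * (((p C (suc m ∸ p)) × 1#) * u ^ p + ((p C (m ∸ p)) × 1#) * u ^ p)
      ≈⟨ *-congˡ (+-cong (when-true (p ≤? suc m) (ℕ.<⇒≤ p<1+m) _) (when-true (p ≤? m) (ℕ.≤-pred p<1+m) _)) ⟨
    u * (binomialTerm (suc m) p + binomialTerm m p) ∎
    where
      1+m∸p : suc m ∸ p ≡ suc (m ∸ p)
      1+m∸p = ℕ.+-∸-assoc 1 (ℕ.≤-pred p<1+m)
      pascal : suc p C (suc m ∸ p) ≡ p C (m ∸ p) ℕ.+ p C (suc m ∸ p)
      pascal = ≡.trans (≡.cong (suc p C_) 1+m∸p)
                 (≡.trans (≡.sym (nCk+nC[k+1]≡[n+1]C[k+1] p (m ∸ p))) (≡.cong (λ k → p C (m ∸ p) ℕ.+ p C k) (≡.sym 1+m∸p)))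
  ... | tri≈ _ ≡.refl _ = begin
    binomialTerm (2 ℕ.+ m) (2 ℕ.+ m)
      ≈⟨ when-true (2 ℕ.+ m ≤? 2 ℕ.+ m) ℕ.≤-refl _ ⟩
    ((suc (suc m) C (m ∸ m)) × 1#) * (u * u ^ suc m)
      ≡⟨ ≡.cong (λ k → ((suc (suc m) C k) × 1#) * (u * u ^ suc m)) (ℕ.n∸n≡0 m) ⟩
    (1 × 1#) * (u * u ^ suc m)
      ≈⟨ solve 3 (λ a u U → a :* (u :* U) := u :* (a :* U)) refl (1 × 1#) u (u ^ suc m) ⟩
    u * ((1 × 1#) * u ^ suc m)
      ≈⟨ *-congˡ (+-identityʳ _) ⟨
    u * ((1 × 1#) * u ^ suc m + 0#)
      ≡⟨ ≡.cong (λ k → u * (((suc m C k) × 1#) * u ^ suc m + 0#)) (ℕ.n∸n≡0 m) ⟨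
    u * (((suc m C (m ∸ m)) × 1#) * u ^ suc m + 0#)
      ≈⟨ *-congˡ (+-cong (when-true (suc m ≤? suc m) ℕ.≤-refl _) (when-false (suc m ≤? m) (ℕ.<-irrefl ≡.refl) _)) ⟨
    u * (binomialTerm (suc m) (suc m) + binomialTerm m (suc m)) ∎
  ... | tri> _ _ 1+m<p = begin
    binomialTerm (2 ℕ.+ m) (suc p)
      ≈⟨ when-false (suc p ≤? 2 ℕ.+ m) (ℕ.<⇒≱ (s≤s 1+m<p)) _ ⟩
    0#
      ≈⟨ zeroʳ u ⟨
    u * 0#
      ≈⟨ *-congˡ (+-identityʳ 0#) ⟨
    u * (0# + 0#)
      ≈⟨ *-congˡ (+-cong (when-false (p ≤? suc m) (ℕ.<⇒≱ 1+m<p) _)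
                         (when-false (p ≤? m) (ℕ.<⇒≱ (ℕ.<-trans (ℕ.n<1+n m) 1+m<p)) _)) ⟨
    u * (binomialTerm (suc m) p + binomialTerm m p) ∎

  binomialSum≈fibPoly : ∀ {m N} → m < N → binomialSum N m ≈ fibPoly m
  binomialSum≈fibPoly {zero} {suc N} _ = begin
    binomialSum (suc N) 0           ≡⟨ Σl-upTo-suc N _ ⟩
    (1# + 0#) * 1# + Σl (upTo N) (λ _ → 0#) ≈⟨ +-cong (trans (*-identityʳ _) (+-identityʳ 1#)) (Σl-0 (upTo N)) ⟩
    1# + 0#                         ≈⟨ +-identityʳ 1# ⟩
    1#                              ∎
  binomialSum≈fibPoly {suc zero} {suc (suc N)} _ = begin
    binomialSum (suc (suc N)) 1     ≡⟨ ≡.trans (Σl-upTo-suc (suc N) _) (≡.cong (0# * 1# +_) (Σl-upTo-suc N _)) ⟩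
    0# * 1# + ((1# + 0#) * (u * 1#) + Σl (upTo N) (λ _ → 0#))
      ≈⟨ +-cong (zeroˡ 1#) (+-cong (*-cong (+-identityʳ 1#) (*-identityʳ u)) (Σl-0 (upTo N))) ⟩
    0# + (1# * u + 0#)              ≈⟨ trans (+-identityˡ _) (trans (+-identityʳ _) (*-identityˡ u)) ⟩
    u                               ∎
  binomialSum≈fibPoly {suc zero} {suc zero} (s≤s ())
  binomialSum≈fibPoly {suc (suc m)} {suc N} (s≤s m<N) = begin
    binomialSum (suc N) (2 ℕ.+ m)
      ≡⟨ Σl-upTo-suc N _ ⟩
    0# * 1# + Σl (upTo N) (λ p → binomialTerm (2 ℕ.+ m) (suc p))
      ≈⟨ trans (+-congʳ (zeroˡ 1#)) (+-identityˡ _) ⟩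
    Σl (upTo N) (λ p → binomialTerm (2 ℕ.+ m) (suc p))
      ≈⟨ trans (Σl-cong (upTo N) (binomialTerm-suc m)) (trans (Σl-*ˡ (upTo N) u _) (*-congˡ (Σl-+ (upTo N) _ _))) ⟩
    u * (binomialSum N (suc m) + binomialSum N m)
      ≈⟨ *-congˡ (+-cong (binomialSum≈fibPoly m<N) (binomialSum≈fibPoly (ℕ.<-trans (ℕ.n<1+n m) m<N))) ⟩
    u * (fibPoly (suc m) + fibPoly m)
      ≈⟨ distribˡ u _ _ ⟩
    fibPoly (2 ℕ.+ m) ∎

module CompositionGF {c ℓ : Level} (R : CommutativeRing c ℓ) (A : List ℕ)
                     (sorted : AllPairs _<_ A) (positive : All (0 <_) A) (y z : CommutativeRing.Carrier R) where
  open CommutativeRing R hiding (zero)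
  open RawSemiring (Semiring.rawSemiring semiring) using (_^_; _×_)
  open GroupProperties +-group using (//-rightDividesˡ)
  open Series R
  open Sums R
  open SeriesProperties R using (oneS≈δ)
  open SublistSums R
  open CompositionSums R A positive
  open NatDecidability
  open SetoidReasoning setoid
  open Solver commutativeSemiring

  u : Carrier
  u = y - 1#

  open ClusterWeights R u

  weight : List ℕ → Carrier
  weight σ = (y ^ occ123 σ) * (z ^ length σ)

  C₁₂₃ : Ser
  C₁₂₃ = C123 A y z

  clusterWeight : ℕ → Carrier
  clusterWeight q = (z ^ q) * cluster q

  clusterGF : Ser
  clusterGF j = Σl (sublists A) (λ S → when (does (sum S ≟ j)) (clusterWeight (length S)))

  clusterWeight-1 : clusterWeight 1 ≈ z
  clusterWeight-1 = trans (*-identityʳ _) (*-identityʳ z)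

  clusterWeight-2 : clusterWeight 2 ≈ 0#
  clusterWeight-2 = zeroʳ _

  clusterWeight-suc³ : ∀ k → clusterWeight (3 ℕ.+ k) ≈ (u * z) * clusterWeight (2 ℕ.+ k) + (u * (z * z)) * clusterWeight (suc k)
  clusterWeight-suc³ k = solve 5 (λ u z Z c₂ c₁ → (z :* (z :* (z :* Z))) :* (u :* c₂ :+ u :* c₁)
                                    := (u :* z) :* ((z :* (z :* Z)) :* c₂) :+ (u :* (z :* z)) :* ((z :* Z) :* c₁))
                                 refl u z (z ^ k) (cluster (2 ℕ.+ k)) (cluster (suc k))

  occ123-rise : ∀ {x b c} ρ → x < b → b < c → occ123 (x ∷ b ∷ c ∷ ρ) ≡ suc (occ123 (b ∷ c ∷ ρ))
  occ123-rise {x} {b} {c} ρ x<b b<c rewrite dec-true (x <? b) x<b | dec-true (b <? c) b<c = ≡.refl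

  occ123-fall₁ : ∀ {x b c} ρ → ¬ x < b → occ123 (x ∷ b ∷ c ∷ ρ) ≡ occ123 (b ∷ c ∷ ρ)
  occ123-fall₁ {x} {b} ρ x≮b rewrite dec-false (x <? b) x≮b = ≡.refl

  occ123-fall₂ : ∀ {x b c} ρ → ¬ b < c → occ123 (x ∷ b ∷ c ∷ ρ) ≡ occ123 (b ∷ c ∷ ρ)
  occ123-fall₂ {x} {b} {c} ρ b≮c rewrite dec-false (b <? c) b≮c with does (x <? b)
  ... | true  = ≡.refl
  ... | false = ≡.refl

  weight-∷-sameOcc : ∀ x τ → occ123 (x ∷ τ) ≡ occ123 τ → weight (x ∷ τ) ≈ z * weight τ
  weight-∷-sameOcc x τ occ≡ = begin
    y ^ occ123 (x ∷ τ) * (z * z ^ length τ) ≡⟨ ≡.cong (λ k → y ^ k * (z * z ^ length τ)) occ≡ ⟩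
    y ^ occ123 τ * (z * z ^ length τ)       ≈⟨ solve 3 (λ Y z Z → Y :* (z :* Z) := z :* (Y :* Z)) refl _ z _ ⟩
    z * weight τ                            ∎

  weight-∷-newOcc : ∀ x τ → occ123 (x ∷ τ) ≡ suc (occ123 τ) → weight (x ∷ τ) ≈ y * (z * weight τ)
  weight-∷-newOcc x τ occ≡ = begin
    y ^ occ123 (x ∷ τ) * (z * z ^ length τ) ≡⟨ ≡.cong (λ k → y ^ k * (z * z ^ length τ)) occ≡ ⟩
    (y * y ^ occ123 τ) * (z * z ^ length τ) ≈⟨ solve 4 (λ y Y z Z → (y :* Y) :* (z :* Z) := y :* (z :* (Y :* Z))) refl y _ z _ ⟩
    y * (z * weight τ)                      ∎

  -- rise f b τ = Σₖ f k · [b < τ₁ < ⋯ < τₖ] · weight (drop k τ)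
  rise riseTail : (ℕ → Carrier) → ℕ → List ℕ → Carrier
  rise f b τ = f 0 * weight τ + riseTail f b τ
  riseTail f b []      = 0#
  riseTail f b (c ∷ ρ) = when (does (b <? c)) (rise (f ∘ suc) c ρ)

  rise-linear : ∀ {h f g : ℕ → Carrier} r s → (∀ k → h k ≈ r * f k + s * g k) →
                ∀ b τ → rise h b τ ≈ r * rise f b τ + s * rise g b τ
  riseTail-linear : ∀ {h f g : ℕ → Carrier} r s → (∀ k → h k ≈ r * f k + s * g k) →
                    ∀ b τ → riseTail h b τ ≈ r * riseTail f b τ + s * riseTail g b τ
  rise-linear {f = f} {g} r s h≈ b τ =
    trans (+-cong (*-congʳ (h≈ 0)) (riseTail-linear r s h≈ b τ))
          (solve 7 (λ r s a b v X Y → (r :* a :+ s :* b) :* v :+ (r :* X :+ s :* Y) := r :* (a :* v :+ X) :+ s :* (b :* v :+ Y))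
                   refl r s (f 0) (g 0) (weight τ) _ _)
  riseTail-linear r s h≈ b []      = sym (trans (+-cong (zeroʳ r) (zeroʳ s)) (+-identityˡ 0#))
  riseTail-linear r s h≈ b (c ∷ ρ) = trans (when-cong β (rise-linear r s (h≈ ∘ suc) c ρ))
                                           (trans (when-+ β _ _) (+-cong (when-*ˡ β r _) (when-*ˡ β s _)))
    where β = does (b <? c)

  weight-∷≈rise-sameOcc : ∀ x τ → occ123 (x ∷ τ) ≡ occ123 τ → riseTail (clusterWeight ∘ suc) x τ ≈ 0# →
                    weight (x ∷ τ) ≈ rise (clusterWeight ∘ suc) x τ
  weight-∷≈rise-sameOcc x τ occ≡ tail≈0 = begin
    weight (x ∷ τ)     ≈⟨ weight-∷-sameOcc x τ occ≡ ⟩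
    z * weight τ       ≈⟨ +-identityʳ _ ⟨
    z * weight τ + 0#  ≈⟨ +-cong (*-congʳ clusterWeight-1) tail≈0 ⟨
    rise (clusterWeight ∘ suc) x τ ∎

  weight-∷≈rise-newOcc : ∀ {x b c} ρ → x < b → b < c →
                  weight (b ∷ c ∷ ρ) ≈ rise (clusterWeight ∘ suc) b (c ∷ ρ) →
                  weight (c ∷ ρ) ≈ rise (clusterWeight ∘ suc) c ρ →
                  weight (x ∷ b ∷ c ∷ ρ) ≈ rise (clusterWeight ∘ suc) x (b ∷ c ∷ ρ)
  weight-∷≈rise-newOcc {x} {b} {c} ρ x<b b<c ih₁ ih₂ = begin
    weight (x ∷ b ∷ c ∷ ρ)  ≈⟨ weight-∷-newOcc x (b ∷ c ∷ ρ) (occ123-rise ρ x<b b<c) ⟩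
    y * (z * X)             ≈⟨ *-congʳ 1+u≈y ⟨
    (1# + u) * (z * X)      ≈⟨ trans (distribʳ _ 1# u) (+-congʳ (*-identityˡ _)) ⟩
    z * X + u * (z * X)     ≈⟨ +-cong (*-congʳ clusterWeight-1) tail ⟨
    rise (clusterWeight ∘ suc) x (b ∷ c ∷ ρ) ∎
    where
      X = weight (b ∷ c ∷ ρ)
      Y = weight (c ∷ ρ)
      P = rise (clusterWeight ∘ suc ∘ suc) c ρ
      1+u≈y : 1# + u ≈ y
      1+u≈y = trans (+-comm 1# u) (//-rightDividesˡ 1# y)
      X≈zY+P : X ≈ z * Y + P
      X≈zY+P = trans ih₁ (+-cong (*-congʳ clusterWeight-1) (when-true (b <? c) b<c _))
      tail : riseTail (clusterWeight ∘ suc) x (b ∷ c ∷ ρ) ≈ u * (z * X)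
      tail = begin
        riseTail (clusterWeight ∘ suc) x (b ∷ c ∷ ρ)
          ≈⟨ when-true (x <? b) x<b _ ⟩
        clusterWeight 2 * Y + when (does (b <? c)) (rise (clusterWeight ∘ suc ∘ suc ∘ suc) c ρ)
          ≈⟨ +-cong (trans (*-congʳ clusterWeight-2) (zeroˡ Y)) (when-true (b <? c) b<c _) ⟩
        0# + rise (clusterWeight ∘ suc ∘ suc ∘ suc) c ρ
          ≈⟨ +-identityˡ _ ⟩
        rise (clusterWeight ∘ suc ∘ suc ∘ suc) c ρ
          ≈⟨ rise-linear (u * z) (u * (z * z)) clusterWeight-suc³ c ρ ⟩
        (u * z) * P + (u * (z * z)) * rise (clusterWeight ∘ suc) c ρ
          ≈⟨ +-congˡ (*-congˡ ih₂) ⟨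
        (u * z) * P + (u * (z * z)) * Y
          ≈⟨ solve 4 (λ u z P Y → (u :* z) :* P :+ (u :* (z :* z)) :* Y := u :* (z :* (z :* Y :+ P))) refl u z P Y ⟩
        u * (z * (z * Y + P))
          ≈⟨ *-congˡ (*-congˡ X≈zY+P) ⟨
        u * (z * X) ∎

  weight-∷≈rise : ∀ x τ → weight (x ∷ τ) ≈ rise (clusterWeight ∘ suc) x τ
  weight-∷≈rise x []           = weight-∷≈rise-sameOcc x [] ≡.refl refl
  weight-∷≈rise x (b ∷ [])     = weight-∷≈rise-sameOcc x (b ∷ []) ≡.refl
    (trans (when-cong _ (trans (+-identityʳ _) (trans (*-congʳ clusterWeight-2) (zeroˡ _)))) (when-0 _))
  weight-∷≈rise x (b ∷ c ∷ ρ) = byCases (x <? b) (b <? c) (weight-∷≈rise b (c ∷ ρ)) (weight-∷≈rise c ρ)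
    where
      byCases : Dec (x < b) → Dec (b < c) →
                weight (b ∷ c ∷ ρ) ≈ rise (clusterWeight ∘ suc) b (c ∷ ρ) →
                weight (c ∷ ρ) ≈ rise (clusterWeight ∘ suc) c ρ →
                weight (x ∷ b ∷ c ∷ ρ) ≈ rise (clusterWeight ∘ suc) x (b ∷ c ∷ ρ)
      byCases (no x≮b)  _         _   _   = weight-∷≈rise-sameOcc x (b ∷ c ∷ ρ) (occ123-fall₁ {x} {b} {c} ρ x≮b)
        (when-false (x <? b) x≮b _)
      byCases (yes x<b) (no b≮c)  _   _   = weight-∷≈rise-sameOcc x (b ∷ c ∷ ρ) (occ123-fall₂ {x} {b} {c} ρ b≮c)
        (trans (when-true (x <? b) x<b _) (trans (+-cong (trans (*-congʳ clusterWeight-2) (zeroˡ _)) (when-false (b <? c) b≮c _))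
                                                 (+-identityˡ 0#)))
      byCases (yes x<b) (yes b<c) ih₁ ih₂ = weight-∷≈rise-newOcc ρ x<b b<c ih₁ ih₂

  Σrise : (ℕ → Carrier) → ℕ → ℕ → Carrier
  Σrise f b m = Σcomp m (rise f b)

  Σabove : (ℕ → Carrier) → ℕ → ℕ → Carrier
  Σabove f b m = Σl (sublists A) (λ S → when (above b S) (f (length S) * when (does (sum S ≤? m)) (C₁₂₃ (m ∸ sum S))))

  Σrise-∷ : ∀ f b m → Σrise f b m ≈ f 0 * C₁₂₃ m
                        + Σl A (λ c → when (does (c ≤? m)) (when (does (b <? c)) (Σrise (f ∘ suc) c (m ∸ c))))
  Σrise-∷ f b m = begin
    Σcomp m (rise f b)
      ≈⟨ Σl-+ (compositions A m) _ _ ⟩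
    Σcomp m (λ τ → f 0 * weight τ) + Σcomp m (riseTail f b)
      ≈⟨ +-cong (Σl-*ˡ (compositions A m) (f 0) weight) (Σcomp-∷ m (riseTail f b)) ⟩
    f 0 * C₁₂₃ m + (when (does (0 ≟ m)) 0# + Σl A (λ c → when (does (c ≤? m)) (Σcomp (m ∸ c) (riseTail f b ∘ (c ∷_)))))
      ≈⟨ +-congˡ (trans (+-congʳ (when-0 _)) (+-identityˡ _)) ⟩
    f 0 * C₁₂₃ m + Σl A (λ c → when (does (c ≤? m)) (Σcomp (m ∸ c) (λ ρ → when (does (b <? c)) (rise (f ∘ suc) c ρ))))
      ≈⟨ +-congˡ (Σl-cong A (λ c → when-cong _ (Σl-when (compositions A (m ∸ c)) _ _))) ⟩
    f 0 * C₁₂₃ m + Σl A (λ c → when (does (c ≤? m)) (when (does (b <? c)) (Σrise (f ∘ suc) c (m ∸ c)))) ∎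

  Σabove-∷ : ∀ f b m → Σabove f b m ≈ f 0 * C₁₂₃ m
                          + Σl A (λ c → when (does (c ≤? m)) (when (does (b <? c)) (Σabove (f ∘ suc) c (m ∸ c))))
  Σabove-∷ f b m = trans (Σl-above-∷ A sorted b _)
    (+-cong (*-congˡ (when-true (0 ≤? m) z≤n _))
            (Σl-cong A (λ c → trans (when-cong _ (tail c)) (when-comm (does (b <? c)) (does (c ≤? m)) _))))
    where
      split : ∀ c S → f (suc (length S)) * when (does (c ℕ.+ sum S ≤? m)) (C₁₂₃ (m ∸ (c ℕ.+ sum S)))
                      ≈ when (does (c ≤? m)) (f (suc (length S)) * when (does (sum S ≤? m ∸ c)) (C₁₂₃ (m ∸ c ∸ sum S)))
      split c S = begin
        f (suc (length S)) * when (does (c ℕ.+ sum S ≤? m)) (C₁₂₃ (m ∸ (c ℕ.+ sum S)))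
          ≡⟨ ≡.cong (λ k → f (suc (length S)) * when (does (c ℕ.+ sum S ≤? m)) (C₁₂₃ k)) (ℕ.∸-+-assoc m c (sum S)) ⟨
        f (suc (length S)) * when (does (c ℕ.+ sum S ≤? m)) (C₁₂₃ (m ∸ c ∸ sum S))
          ≈⟨ *-congˡ (trans (when-≡ _ (≤?-+ˡ c (sum S) m)) (when-∧ (does (c ≤? m)) _ _)) ⟩
        f (suc (length S)) * when (does (c ≤? m)) (when (does (sum S ≤? m ∸ c)) (C₁₂₃ (m ∸ c ∸ sum S)))
          ≈⟨ when-*ˡ _ _ _ ⟨
        when (does (c ≤? m)) (f (suc (length S)) * when (does (sum S ≤? m ∸ c)) (C₁₂₃ (m ∸ c ∸ sum S))) ∎
      tail : ∀ c → Σl (sublists A) (λ S → when (above c S)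
                      (f (suc (length S)) * when (does (c ℕ.+ sum S ≤? m)) (C₁₂₃ (m ∸ (c ℕ.+ sum S)))))
                   ≈ when (does (c ≤? m)) (Σabove (f ∘ suc) c (m ∸ c))
      tail c = trans (Σl-cong (sublists A) (λ S → trans (when-cong (above c S) (split c S)) (when-comm (above c S) (does (c ≤? m)) _)))
                     (Σl-when (sublists A) (does (c ≤? m)) _)

  -- Both sides satisfy the same recursion, along which m strictly decreases since parts are positive.
  Σrise≈Σabove : ∀ m f b → Σrise f b m ≈ Σabove f b m
  Σrise≈Σabove = <-rec (λ m → ∀ f b → Σrise f b m ≈ Σabove f b m) λ m ih f b → begin
    Σrise f b m
      ≈⟨ Σrise-∷ f b m ⟩
    f 0 * C₁₂₃ m + Σl A (λ c → when (does (c ≤? m)) (when (does (b <? c)) (Σrise (f ∘ suc) c (m ∸ c))))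
      ≈⟨ +-congˡ (Σl-congᴬ positive (λ c 0<c → when-congᵈ (c ≤? m) (λ c≤m →
           when-cong _ (ih (ℕ.∸-monoʳ-< 0<c c≤m) (f ∘ suc) c)))) ⟩
    f 0 * C₁₂₃ m + Σl A (λ c → when (does (c ≤? m)) (when (does (b <? c)) (Σabove (f ∘ suc) c (m ∸ c))))
      ≈⟨ Σabove-∷ f b m ⟨
    Σabove f b m ∎

  C-∷ : ∀ n → C₁₂₃ n ≈ oneS n + Σl A (λ c → when (does (c ≤? n)) (Σrise (clusterWeight ∘ suc) c (n ∸ c)))
  C-∷ n = trans (Σcomp-∷ n weight)
    (+-cong (trans (when-cong _ (*-identityʳ 1#)) (sym (oneS≈δ n)))
            (Σl-cong A (λ c → when-cong _ (Σl-cong (compositions A (n ∸ c)) (weight-∷≈rise c)))))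

  Σabove≈⊗ : ∀ n → Σabove clusterWeight 0 n ≈ (C₁₂₃ ⊗ clusterGF) n
  Σabove≈⊗ n = begin
    Σabove clusterWeight 0 n
      ≈⟨ Σl-above-all A positive _ ⟩
    Σl (sublists A) (λ S → clusterWeight (length S) * when (does (sum S ≤? n)) (C₁₂₃ (n ∸ sum S)))
      ≈⟨ Σl-cong (sublists A) (λ S → trans (sym (when-*ˡ _ _ _)) (when-cong _ (*-comm _ _))) ⟩
    Σl (sublists A) (λ S → when (does (sum S ≤? n)) (C₁₂₃ (n ∸ sum S) * clusterWeight (length S)))
      ≈⟨ Σl-cong (sublists A) (λ S → Σl-upTo-δ∸ n (sum S) (λ k → C₁₂₃ k * clusterWeight (length S))) ⟨
    Σl (sublists A) (λ S → Σl (upTo (suc n)) (λ k → when (does (sum S ≟ n ∸ k)) (C₁₂₃ k * clusterWeight (length S))))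
      ≈⟨ Σl-swap (sublists A) (upTo (suc n)) _ ⟩
    Σl (upTo (suc n)) (λ k → Σl (sublists A) (λ S → when (does (sum S ≟ n ∸ k)) (C₁₂₃ k * clusterWeight (length S))))
      ≈⟨ Σl-cong (upTo (suc n)) (λ k → trans (Σl-cong (sublists A) (λ S → when-*ˡ _ (C₁₂₃ k) _))
                                               (Σl-*ˡ (sublists A) (C₁₂₃ k) _)) ⟩
    (C₁₂₃ ⊗ clusterGF) n ∎

  renewal : ∀ n → C₁₂₃ n ≈ oneS n + (C₁₂₃ ⊗ clusterGF) n
  renewal n = begin
    C₁₂₃ n
      ≈⟨ C-∷ n ⟩
    oneS n + Σl A (λ c → when (does (c ≤? n)) (Σrise (clusterWeight ∘ suc) c (n ∸ c)))
      ≈⟨ +-congˡ (Σl-congᴬ positive (λ c 0<c → when-cong _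
           (trans (Σrise≈Σabove (n ∸ c) (clusterWeight ∘ suc) c) (sym (when-true (0 <? c) 0<c _))))) ⟩
    oneS n + Σl A (λ c → when (does (c ≤? n)) (when (does (0 <? c)) (Σabove (clusterWeight ∘ suc) c (n ∸ c))))
      ≈⟨ +-congˡ (trans (+-congʳ (trans (*-congʳ (zeroʳ 1#)) (zeroˡ _))) (+-identityˡ _)) ⟨
    oneS n + (clusterWeight 0 * C₁₂₃ n
              + Σl A (λ c → when (does (c ≤? n)) (when (does (0 <? c)) (Σabove (clusterWeight ∘ suc) c (n ∸ c)))))
      ≈⟨ +-congˡ (Σabove-∷ clusterWeight 0 n) ⟨
    oneS n + Σabove clusterWeight 0 n
      ≈⟨ +-congˡ (Σabove≈⊗ n) ⟩
    oneS n + (C₁₂₃ ⊗ clusterGF) n ∎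

  denominatorCoeff : ℕ → ℕ → Carrier
  denominatorCoeff p j = (((p ∸ 3) C j) × 1#) * (u ^ (p ∸ 2))

  -- The coefficient with which a sublist of length q enters the part of D subtracted from 1.
  denominatorWeight : ℕ → Carrier
  denominatorWeight q = when (does (q ≟ 1)) (z ^ 1) + Σl (range 3 (length A)) (λ p → Σl (range 0 (p ∸ 3)) (λ j →
                          denominatorCoeff p j * when (does (q ≟ p ℕ.+ j)) (z ^ (p ℕ.+ j))))

  t≈Σl-sublists : ∀ p j → t A z p j ≈ Σl (sublists A) (λ S → when (does (sum S ≟ j)) (when (does (length S ≟ p)) (z ^ p)))
  t≈Σl-sublists p j = begin
    count A p j × z ^ p
      ≈⟨ Σl-const (filter (λ S → sum S ≟ j) (filter (λ S → length S ≟ p) (sublists A))) _ ⟨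
    Σl (filter (λ S → sum S ≟ j) (filter (λ S → length S ≟ p) (sublists A))) (λ _ → z ^ p)
      ≈⟨ Σl-filter (λ S → sum S ≟ j) (filter (λ S → length S ≟ p) (sublists A)) _ ⟩
    Σl (filter (λ S → length S ≟ p) (sublists A)) (λ S → when (does (sum S ≟ j)) (z ^ p))
      ≈⟨ Σl-filter (λ S → length S ≟ p) (sublists A) _ ⟩
    Σl (sublists A) (λ S → when (does (length S ≟ p)) (when (does (sum S ≟ j)) (z ^ p)))
      ≈⟨ Σl-cong (sublists A) (λ S → when-comm (does (length S ≟ p)) (does (sum S ≟ j)) _) ⟩
    Σl (sublists A) (λ S → when (does (sum S ≟ j)) (when (does (length S ≟ p)) (z ^ p))) ∎

  Σl-range-δ : ∀ p q → Σl (range 0 (p ∸ 3)) (λ j → denominatorCoeff p j * when (does (q ≟ p ℕ.+ j)) (z ^ (p ℕ.+ j)))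
                         ≈ when (does (p ≤? q)) (denominatorCoeff p (q ∸ p) * z ^ q)
  Σl-range-δ p q = begin
    Σl (range 0 (p ∸ 3)) (λ j → denominatorCoeff p j * when (does (q ≟ p ℕ.+ j)) (z ^ (p ℕ.+ j)))
      ≡⟨ Σl-map (0 ℕ.+_) (upTo (suc (p ∸ 3))) _ ⟩
    Σl (upTo (suc (p ∸ 3))) (λ j → denominatorCoeff p j * when (does (q ≟ p ℕ.+ j)) (z ^ (p ℕ.+ j)))
      ≈⟨ Σl-cong (upTo (suc (p ∸ 3))) term ⟩
    Σl (upTo (suc (p ∸ 3))) (λ j → when (does (p ≤? q)) (when (does (j ≟ q ∸ p)) (denominatorCoeff p j * z ^ q)))
      ≈⟨ Σl-when (upTo (suc (p ∸ 3))) (does (p ≤? q)) _ ⟩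
    when (does (p ≤? q)) (Σl (upTo (suc (p ∸ 3))) (λ j → when (does (j ≟ q ∸ p)) (denominatorCoeff p j * z ^ q)))
      ≈⟨ when-cong (does (p ≤? q)) (Σl-upTo-δ (suc (p ∸ 3)) (q ∸ p) _) ⟩
    when (does (p ≤? q)) (when (does (q ∸ p <? suc (p ∸ 3))) (denominatorCoeff p (q ∸ p) * z ^ q))
      ≈⟨ when-cong (does (p ≤? q)) (when-absorb (q ∸ p <? suc (p ∸ 3)) vanish) ⟩
    when (does (p ≤? q)) (denominatorCoeff p (q ∸ p) * z ^ q) ∎
    where
      term : ∀ j → denominatorCoeff p j * when (does (q ≟ p ℕ.+ j)) (z ^ (p ℕ.+ j))
                   ≈ when (does (p ≤? q)) (when (does (j ≟ q ∸ p)) (denominatorCoeff p j * z ^ q))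
      term j = begin
        denominatorCoeff p j * when (does (q ≟ p ℕ.+ j)) (z ^ (p ℕ.+ j))
          ≈⟨ *-congˡ (trans (when-≡ _ (≟-+ʳ q p j)) (when-∧ (does (p ≤? q)) _ _)) ⟩
        denominatorCoeff p j * when (does (p ≤? q)) (when (does (j ≟ q ∸ p)) (z ^ (p ℕ.+ j)))
          ≈⟨ when-*ˡ (does (p ≤? q)) _ _ ⟨
        when (does (p ≤? q)) (denominatorCoeff p j * when (does (j ≟ q ∸ p)) (z ^ (p ℕ.+ j)))
          ≈⟨ when-congᵈ (p ≤? q) (λ p≤q → trans (sym (when-*ˡ (does (j ≟ q ∸ p)) _ _))
               (when-congᵈ (j ≟ q ∸ p) (λ { ≡.refl → *-congˡ (reflexive (≡.cong (z ^_) (ℕ.m+[n∸m]≡n p≤q))) }))) ⟩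
        when (does (p ≤? q)) (when (does (j ≟ q ∸ p)) (denominatorCoeff p j * z ^ q)) ∎
      vanish : ¬ (q ∸ p < suc (p ∸ 3)) → denominatorCoeff p (q ∸ p) * z ^ q ≈ 0#
      vanish q∸p≮ = begin
        ((((p ∸ 3) C (q ∸ p)) × 1#) * u ^ (p ∸ 2)) * z ^ q
          ≡⟨ ≡.cong (λ k → ((k × 1#) * u ^ (p ∸ 2)) * z ^ q) (k>n⇒nCk≡0 (ℕ.≮⇒≥ q∸p≮)) ⟩
        (0# * u ^ (p ∸ 2)) * z ^ q ≈⟨ trans (*-congʳ (zeroˡ _)) (zeroˡ _) ⟩
        0# ∎

  denominatorWeight≈clusterWeight : ∀ q → q ≤ length A → denominatorWeight q ≈ clusterWeight q
  denominatorWeight≈clusterWeight q q≤d = trans reindexed (byLength q q≤d)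
    where
      N = suc (length A) ∸ 3
      reindexed : denominatorWeight q ≈ when (does (q ≟ 1)) (z ^ 1) +
                    Σl (upTo N) (λ p → when (does (3 ℕ.+ p ≤? q)) (denominatorCoeff (3 ℕ.+ p) (q ∸ (3 ℕ.+ p)) * z ^ q))
      reindexed = +-congˡ (trans (Σl-cong (range 3 (length A)) (λ p → Σl-range-δ p q))
                                 (reflexive (Σl-map (3 ℕ.+_) (upTo N) _)))
      byLength : ∀ q → q ≤ length A → when (does (q ≟ 1)) (z ^ 1) +
                   Σl (upTo N) (λ p → when (does (3 ℕ.+ p ≤? q)) (denominatorCoeff (3 ℕ.+ p) (q ∸ (3 ℕ.+ p)) * z ^ q))
                   ≈ clusterWeight q
      byLength 0 _ = trans (+-identityˡ _) (trans (Σl-0 (upTo N)) (sym (zeroʳ _)))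
      byLength 1 _ = trans (+-congˡ (Σl-0 (upTo N))) (trans (+-identityʳ _) (sym (*-identityʳ _)))
      byLength 2 _ = trans (+-identityˡ _) (trans (Σl-0 (upTo N)) (sym (zeroʳ _)))
      byLength q@(suc (suc (suc m))) q≤d = begin
        0# + Σl (upTo N) (λ p → when (does (3 ℕ.+ p ≤? q)) ((((p C (m ∸ p)) × 1#) * (u * u ^ p)) * z ^ q))
          ≈⟨ trans (+-identityˡ _) (Σl-cong (upTo N) term) ⟩
        Σl (upTo N) (λ p → binomialTerm m p * (u * z ^ q))
          ≈⟨ Σl-*ʳ (upTo N) _ _ ⟩
        binomialSum N m * (u * z ^ q)
          ≈⟨ *-congʳ (binomialSum≈fibPoly (ℕ.∸-monoˡ-≤ 2 q≤d)) ⟩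
        fibPoly m * (u * z ^ q)
          ≈⟨ solve 3 (λ F u Z → F :* (u :* Z) := Z :* (u :* F)) refl (fibPoly m) u (z ^ q) ⟩
        z ^ q * (u * fibPoly m)
          ≈⟨ *-congˡ (cluster-fibPoly m) ⟨
        clusterWeight q ∎
        where
          term : ∀ p → when (does (3 ℕ.+ p ≤? q)) ((((p C (m ∸ p)) × 1#) * (u * u ^ p)) * z ^ q) ≈ binomialTerm m p * (u * z ^ q)
          term p = begin
            when (does (3 ℕ.+ p ≤? q)) ((((p C (m ∸ p)) × 1#) * (u * u ^ p)) * z ^ q)
              ≈⟨ when-≡ _ (≡.trans (≤?-suc (2 ℕ.+ p) (2 ℕ.+ m)) (≡.trans (≤?-suc (suc p) (suc m)) (≤?-suc p m))) ⟩
            when (does (p ≤? m)) ((((p C (m ∸ p)) × 1#) * (u * u ^ p)) * z ^ q)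
              ≈⟨ when-cong _ (solve 4 (λ b u U Z → (b :* (u :* U)) :* Z := (b :* U) :* (u :* Z)) refl _ u (u ^ p) (z ^ q)) ⟩
            when (does (p ≤? m)) ((((p C (m ∸ p)) × 1#) * u ^ p) * (u * z ^ q))
              ≈⟨ when-*ʳ (does (p ≤? m)) _ _ ⟩
            binomialTerm m p * (u * z ^ q) ∎

  t-combination : ∀ j → t A z 1 j + Σl (range 3 (length A)) (λ p → Σl (range 0 (p ∸ 3)) (λ i →
                                       denominatorCoeff p i * t A z (p ℕ.+ i) j))
                        ≈ Σl (sublists A) (λ S → when (does (sum S ≟ j)) (denominatorWeight (length S)))
  t-combination j = begin
    t A z 1 j + Σl r₃ (λ p → Σl (range 0 (p ∸ 3)) (λ i → denominatorCoeff p i * t A z (p ℕ.+ i) j))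
      ≈⟨ +-cong (t≈Σl-sublists 1 j) (Σl-cong r₃ (λ p → Σl-cong (range 0 (p ∸ 3)) (λ i →
           trans (*-congˡ (t≈Σl-sublists (p ℕ.+ i) j))
                 (trans (sym (Σl-*ˡ (sublists A) _ _)) (Σl-cong (sublists A) (λ S → sym (when-*ˡ (does (sum S ≟ j)) _ _))))))) ⟩
    Σl (sublists A) (λ S → δ S (when (does (length S ≟ 1)) (z ^ 1)))
      + Σl r₃ (λ p → Σl (range 0 (p ∸ 3)) (λ i → Σl (sublists A) (λ S → δ S (term S p i))))
      ≈⟨ +-congˡ (trans (Σl-cong r₃ (λ p → Σl-swap (range 0 (p ∸ 3)) (sublists A) _)) (Σl-swap r₃ (sublists A) _)) ⟩
    Σl (sublists A) (λ S → δ S (when (does (length S ≟ 1)) (z ^ 1)))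
      + Σl (sublists A) (λ S → Σl r₃ (λ p → Σl (range 0 (p ∸ 3)) (λ i → δ S (term S p i))))
      ≈⟨ Σl-+ (sublists A) _ _ ⟨
    Σl (sublists A) (λ S → δ S (when (does (length S ≟ 1)) (z ^ 1))
                           + Σl r₃ (λ p → Σl (range 0 (p ∸ 3)) (λ i → δ S (term S p i))))
      ≈⟨ Σl-cong (sublists A) (λ S →
           trans (+-congˡ (trans (Σl-cong r₃ (λ p → Σl-when (range 0 (p ∸ 3)) _ _)) (Σl-when r₃ _ _)))
                 (sym (when-+ (does (sum S ≟ j)) _ _))) ⟩
    Σl (sublists A) (λ S → δ S (denominatorWeight (length S))) ∎
    where
      r₃ = range 3 (length A)
      δ : List ℕ → Carrier → Carrier
      δ S x = when (does (sum S ≟ j)) x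
      term : List ℕ → ℕ → ℕ → Carrier
      term S p i = denominatorCoeff p i * when (does (length S ≟ p ℕ.+ i)) (z ^ (p ℕ.+ i))

  denominator : ∀ j → D A y z j ≈ (oneS ⊕ (⊝ clusterGF)) j
  denominator j = +-congˡ (-‿cong (trans (t-combination j) (Σl-congᴬ (sublists-length A) (λ S |S|≤d →
    when-cong (does (sum S ≟ j)) (denominatorWeight≈clusterWeight (length S) |S|≤d)))))

open SeriesProperties using (⊗-congʳ; ⊗-oneS-⊝ʳ)

theorem3 : {c ℓ : Level} (R : CommutativeRing c ℓ) (A : List ℕ) →
    AllPairs _<_ A → All (0 <_) A →
    (y z : CommutativeRing.Carrier R) (n : ℕ) →
    CommutativeRing._≈_ R
      (Series._⊗_ R (Series.C123 R A y z) (Series.D R A y z) n)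
      (Series.oneS R n)
theorem3 R A sorted positive y z n = begin
  (C₁₂₃ ⊗ D A y z) n                               ≈⟨ ⊗-congʳ R C₁₂₃ denominator n ⟩
  (C₁₂₃ ⊗ (oneS ⊕ (⊝ clusterGF))) n                ≈⟨ ⊗-oneS-⊝ʳ R C₁₂₃ clusterGF n ⟩
  C₁₂₃ n - (C₁₂₃ ⊗ clusterGF) n                    ≈⟨ +-congʳ (renewal n) ⟩
  oneS n + (C₁₂₃ ⊗ clusterGF) n - (C₁₂₃ ⊗ clusterGF) n ≈⟨ //-rightDividesʳ ((C₁₂₃ ⊗ clusterGF) n) (oneS n) ⟩
  oneS n                                           ∎
  where
    open CommutativeRing R
    open Series R
    open CompositionGF R A sorted positive y z
    open GroupProperties +-group using (//-rightDividesʳ)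
    open SetoidReasoning setoid
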